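{- Let $S$ be a set and $\mathcal{A}$ a saturation on $S$, and let $\mathbb{J}(\mathcal{A})$ be the greatest reduction on $S$ compatible with $\mathcal{A}$ (on the right). Then for all $a\in S$ and $V\subseteq S$: $$a\in\mathbb{J}(\mathcal{A})(V)\iff \text{there exists } Z\subseteq S \text{ with } a\in Z\subseteq V \text{ and } Z \text{ splits } \mathcal{A}.$$ Moreover, for every reduction $\mathcal{J}$ on $S$: $\mathcal{A}\triangleleft\mathcal{J}$ if and only if $\mathcal{J}\subseteq\mathbb{J}(\mathcal{A})$.
   Context: All reasoning is intuitionistic (no law of excluded middle); impredicative constructions are allowed. An operator on $S$ is a map $\mathrm{Pow}(S)\to\mathrm{Pow}(S)$; $\mathcal{O}_1\subseteq\mathcal{O}_2$ means $\mathcal{O}_1(U)\subseteq\mathcal{O}_2(U)$ for all $U$. For $U,V\subseteq S$, $U\between V$ means there exists $a\in U\cap V$. $\mathcal{O}\triangleleft\mathcal{O}'$ means: for all $U,V\subseteq S$, $\mathcal{O}(U)\between\mathcal{O}'(V)$ implies $U\between\mathcal{O}'(V)$. A subset $Z\subseteq S$ splits an operator $\mathcal{O}$ if for all $U\subseteq S$, $\mathcal{O}(U)\between Z$ implies $U\between Z$. A saturation is a monotone idempotent operator $\mathcal{A}$ with $U\subseteq\mathcal{A}(U)$ for all $U$; a reduction is a monotone idempotent operator $\mathcal{J}$ with $\mathcal{J}(U)\subseteq U$ for all $U$. $\mathbb{J}(\mathcal{A})$ is the greatest reduction $\mathcal{J}$ (w.r.t. $\subseteq$) with $\mathcal{A}\triangleleft\mathcal{J}$;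 it exists. -}

module Defs where

open import Level using (Level; suc; _⊔_)
open import Data.Product using (_×_; Σ; ∃)
open import Relation.Unary using (Pred; _⊆_; _≬_; _∈_)

Operator : ∀ {ℓ} → Set ℓ → Set (suc ℓ)
Operator {ℓ} S = Pred S ℓ → Pred S ℓ

_⊆ₒ_ : ∀ {ℓ} {S : Set ℓ} → Operator S → Operator S → Set (suc ℓ)
O₁ ⊆ₒ O₂ = ∀ U → O₁ U ⊆ O₂ U

Monotone : ∀ {ℓ} {S : Set ℓ} → Operator S → Set (suc ℓ)
Monotone O = ∀ {U V} → U ⊆ V → O U ⊆ O V

Idempotent : ∀ {ℓ} {S : Set ℓ} → Operator S → Set (suc ℓ)
Idempotent O = ∀ U → (O (O U) ⊆ O U) × (O U ⊆ O (O U))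

record IsSaturation {ℓ} {S : Set ℓ} (A : Operator S) : Set (suc ℓ) where
  field
    monotone   : Monotone A
    idempotent : Idempotent A
    extensive  : ∀ U → U ⊆ A U

record IsReduction {ℓ} {S : Set ℓ} (J : Operator S) : Set (suc ℓ) where
  field
    monotone   : Monotone J
    idempotent : Idempotent J
    reductive  : ∀ U → J U ⊆ U

_◁_ : ∀ {ℓ} {S : Set ℓ} → Operator S → Operator S → Set (suc ℓ)
O ◁ O' = ∀ U V → O U ≬ O' V → U ≬ O' V

Splits : ∀ {ℓ} {S : Set ℓ} → Pred S ℓ → Operator S → Set (suc ℓ)
Splits Z O = ∀ U → O U ≬ Z → U ≬ Z

record IsGreatestCompatibleReduction {ℓ} {S : Set ℓ} (A JA : Operator S) : Set (suc ℓ) where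
  field
    isReduction : IsReduction JA
    compatible  : A ◁ JA
    greatest    : ∀ (J : Operator S) → IsReduction J → A ◁ J → J ⊆ₒ JA

-- Each set J(V) of a compatible reduction J splits A; conversely a
-- splitting Z generates the reduction W ↦ {x ∈ Z ∣ Z ⊆ W}, which is compatible
-- with A, so maximality of 𝕁(A) puts Z, hence a, inside 𝕁(A)(V).  The second
-- part combines maximality with the fact that compatibility passes to smaller
-- reductions.
module Submission where

open import Defs
open import Level using (Level)
open import Data.Product using (_×_; Σ; _,_; proj₂)
open import Relation.Unary using (Pred; _⊆_; _∈_)
open import Function.Bundles using (_⇔_; mk⇔)

module _ {ℓ : Level} {S : Set ℓ} where

  ◁⇒Splits : ∀ {A J : Operator S} → A ◁ J → ∀ V → Splits (J V) A
  ◁⇒Splits A◁J V U = A◁J U V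

  Cut : Pred S ℓ → Operator S
  Cut Z W x = Z x × Z ⊆ W

  Cut-isReduction : ∀ Z → IsReduction (Cut Z)
  Cut-isReduction Z = record
    { monotone   = λ U⊆V (z , Z⊆U) → z , (λ y → U⊆V (Z⊆U y))
    ; idempotent = λ W → (λ (z , Z⊆CutW) → z , (λ y → proj₂ (Z⊆CutW y) y))
                       , (λ (z , Z⊆W) → z , (λ y → y , Z⊆W))
    ; reductive  = λ W (z , Z⊆W) → Z⊆W z
    }

  Cut-⊇ : ∀ {Z V} → Z ⊆ V → Z ⊆ Cut Z V
  Cut-⊇ Z⊆V z = z , Z⊆V

  Splits⇒◁Cut : ∀ {Z} {A : Operator S} → Splits Z A → A ◁ Cut Z
  Splits⇒◁Cut split U W (x , x∈AU , x∈Z , Z⊆W) with split U (x , x∈AU , x∈Z)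
  ... | u , u∈U , u∈Z = u , u∈U , u∈Z , Z⊆W

  -- J V ⊆ J (J V) lets a witness in J' (J V) be pulled back into J V.
  ◁-antitone : ∀ {A J J' : Operator S} → IsReduction J → IsReduction J'
             → J ⊆ₒ J' → A ◁ J' → A ◁ J
  ◁-antitone {J = J} redJ redJ' J⊆J' A◁J' U V (x , x∈AU , x∈JV)
    with A◁J' U (J V) (x , x∈AU , J⊆J' (J V) (proj₂ (IsReduction.idempotent redJ V) x∈JV))
  ... | u , u∈U , u∈J'JV = u , u∈U , IsReduction.reductive redJ' (J V) u∈J'JV

  module _ {A JA : Operator S} (𝕁 : IsGreatestCompatibleReduction A JA) where
    open IsGreatestCompatibleReduction 𝕁

    ∈𝕁⇔∃splitting : ∀ a V
      → (a ∈ JA V) ⇔ Σ (Pred S ℓ) (λ Z → (a ∈ Z) × (Z ⊆ V) × Splits Z A)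
    ∈𝕁⇔∃splitting a V = mk⇔
      (λ a∈JAV → JA V , a∈JAV , (λ {x} → IsReduction.reductive isReduction V {x}) , ◁⇒Splits compatible V)
      (λ (Z , a∈Z , Z⊆V , split) →
        greatest (Cut Z) (Cut-isReduction Z) (Splits⇒◁Cut split) V (Cut-⊇ Z⊆V a∈Z))

    ◁⇔⊆𝕁 : ∀ J → IsReduction J → (A ◁ J) ⇔ (J ⊆ₒ JA)
    ◁⇔⊆𝕁 J redJ = mk⇔ (greatest J redJ) (λ J⊆JA → ◁-antitone redJ isReduction J⊆JA compatible)

proposition2p11 : ∀ {ℓ : Level} (S : Set ℓ) (A JA : Operator S)
    → IsSaturation A
    → IsGreatestCompatibleReduction A JA
    → (∀ (a : S) (V : Pred S ℓ)
         → (a ∈ JA V) ⇔ Σ (Pred S ℓ) (λ Z → (a ∈ Z) × (Z ⊆ V) × Splits Z A))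
      × (∀ (J : Operator S) → IsReduction J → ((A ◁ J) ⇔ (J ⊆ₒ JA)))
proposition2p11 S A JA _ 𝕁 = ∈𝕁⇔∃splitting 𝕁 , ◁⇔⊆𝕁 𝕁
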